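{- The structure $\mathcal{S} = (\mathbb{A}/_{\simeq_\mathbb{A}^{\text{ae}}},\bullet,[\![-]\!]_{ - })$ defined below is a syntactic $\lambda$-model.
   Context: Setting (addressing machines). Fix a countable set $\mathbb{A}$ of addresses and a symbol $\varnothing\notin\mathbb{A}$ (uninitialized register). An addressing machine is a triple $\mathsf{M}=\langle R_0,\dots,R_{r-1},P,T\rangle$ where each register $R_i$ holds $\varnothing$ or an address, $T=[a_1,\dots,a_n]$ is a finite list of addresses (the input tape), and $P$ is a program valid w.r.t. the registers: a list of instructions of shape $\mathsf{Load}\,i$'s, followed by $\mathsf{App}\,i\,j\,k$'s, optionally ending with $\mathsf{Call}\,i$, such that registers are only read (by $\mathsf{App}$ as $i,j$ or by $\mathsf{Call}$) when they exist and are initialized (writing to a non-existing register index, denoted "$-$", just discards the value). Let $\mathcal{M}$ be the set of all addressing machines. Fix a bijection $\#:\mathcal{M}\to\mathbb{A}$ with inverse $\#^{ -1}$. For a machine $\mathsf{M}$ and tape $T'$, $\mathsf{M}@T'$ is $\mathsf{M}$ with $T'$ appended to its tape; application on addresses is $a\cdot b=\#(\#^{ -1}(a)@[b])$. Head reduction $\to_h$ is: $\langle\vec R,\mathsf{Load}\,i;P,a{::}T\rangle\to_h\langle\vec R[R_i:=a],P,T\rangle$; $\langle\vec R,\mathsf{App}\,i\,j\,k;P,T\rangle\to_h\langle\vec R[R_k:=R_i\cdot R_j],P,T\rangle$; $\langle\vec R,\mathsf{Call}\,i,T\rangle\to_h \#^{ -1}(R_i)@T$; $\twoheadrightarrow_h$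 is its reflexive-transitive closure. A machine is stuck if its program starts with $\mathsf{Load}$ and its tape is empty; $\mathsf{M}\twoheadrightarrow_h\mathrm{stuck}$ means it reduces to a stuck machine. Applicative equivalence: $\equiv_\mathbb{A}^{\text{ae}}$ is the least equivalence relation on $\mathcal{M}$ closed under: (1) if $\mathsf{M}\twoheadrightarrow_h\mathsf{Z}$ and $\mathsf{Z}=_\mathbb{A}^{\text{ae}}\mathsf{N}$ then $\mathsf{M}\equiv_\mathbb{A}^{\text{ae}}\mathsf{N}$; (2) if $\mathsf{M}\twoheadrightarrow_h\mathrm{stuck}$, $\mathsf{N}\twoheadrightarrow_h\mathrm{stuck}$ and for all $a\in\mathbb{A}$, $\mathsf{M}@[a]\equiv_\mathbb{A}^{\text{ae}}\mathsf{N}@[a]$, then $\mathsf{M}\equiv_\mathbb{A}^{\text{ae}}\mathsf{N}$. Here $a\simeq_\mathbb{A}^{\text{ae}} b$ iff $\#^{ -1}(a)\equiv_\mathbb{A}^{\text{ae}}\#^{ -1}(b)$, and $\mathsf{Z}=_\mathbb{A}^{\text{ae}}\mathsf{N}$ means they have the same program, the same number of registers with corresponding registers either both $\varnothing$ or holding $\simeq_\mathbb{A}^{\text{ae}}$-related addresses, and tapes of equal length with pointwise $\simeq_\mathbb{A}^{\text{ae}}$-related entries. $\simeq_\mathbb{A}^{\text{ae}}$ is a congruence for $\cdot$. Interpretation. $\Lambda(\mathbb{A})$ is the set of $\lambda$-terms with constants $\underline{a}$ for $a\in\mathbb{A}$. For $M\in\Lambda(\mathbb{A})$ with free variables among $\vec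 x=x_1,\dots,x_n$, define the machine $[M]_{\vec x}$ by: $[x_i]_{\vec x}=\mathsf{Pr}^n_i$, the one-register machine whose program loads its first $n$ tape entries, storing only the $i$-th into $R_0$, then executes $\mathsf{Call}\,0$; $[\underline{a}]_{\vec x}=\mathsf{Cons}^n_a=\langle a,(\mathsf{Load}\,-)^n;\mathsf{Call}\,0,[]\rangle$; $[MN]_{\vec x}=\langle\varnothing^n,\#[M]_{\vec x},\#[N]_{\vec x},\varnothing,\mathsf{Apply}_n,[]\rangle$ where $\mathsf{Apply}_n=\mathsf{Load}(0,\dots,n-1);\mathsf{App}\,n\,0\,n;\cdots;\mathsf{App}\,n\,(n-1)\,n;\mathsf{App}\,(n+1)\,0\,(n+1);\cdots;\mathsf{App}\,(n+1)\,(n-1)\,(n+1);\mathsf{App}\,n\,(n+1)\,(n+2);\mathsf{Call}\,(n+2)$; $[\lambda y.M]_{\vec x}=[M]_{\vec x,y}$ (with $y\notin\vec x$). Then $[a]\bullet[b]=[a\cdot b]$ on $\simeq_\mathbb{A}^{\text{ae}}$-classes, and $[\![M]\!]_\rho$ is the class of $\#([M]_{\vec x}@[\rho(x_1),\dots,\rho(x_n)])$ for a valuation $\rho:\mathrm{Var}\to\mathbb{A}$ (independent of the choice of $\vec x\supseteq FV(M)$). A syntactic $\lambda$-model is $(A,\cdot,[\![-]\!]_-)$ with $(A,\cdot)$ an applicative structure and $[\![-]\!]:\Lambda(A)\times(\mathrm{Var}\to A)\to A$ satisfying: $[\![x]\!]_\rho=\rho(x)$; $[\![\underline a]\!]_\rho=a$;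 $[\![PQ]\!]_\rho=[\![P]\!]_\rho\cdot[\![Q]\!]_\rho$; $[\![\lambda x.P]\!]_\rho\cdot a=[\![P]\!]_{\rho[x:=a]}$ for all $a$; if $\rho,\rho'$ agree on $FV(M)$ then $[\![M]\!]_\rho=[\![M]\!]_{\rho'}$; if $[\![M]\!]_{\rho[x:=a]}=[\![N]\!]_{\rho[x:=a]}$ for all $a\in A$ then $[\![\lambda x.M]\!]_\rho=[\![\lambda x.N]\!]_\rho$. -}

module Defs where

open import Data.Nat using (ℕ; zero; suc; _+_; _≤_; _<_; _⊔_; pred; _<ᵇ_; _≡ᵇ_; z≤n; s≤s)
open import Data.Nat.Properties using (<⇒<ᵇ; ≡⇒≡ᵇ; m≤m+n; m⊔n≤o⇒m≤o; m⊔n≤o⇒n≤o; ≤-refl; +-suc)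
open import Data.Bool using (Bool; true; false; _∧_; _∨_; T)
open import Data.Unit using (tt)
open import Data.Maybe using (Maybe; just; nothing; is-just)
open import Data.Product using (_×_; _,_; proj₁; proj₂)
open import Data.Sum using (_⊎_; inj₁; inj₂)
open import Data.List using (List; []; _∷_; _++_; map; replicate; downFrom)
open import Data.List.Relation.Unary.All using (All; []; _∷_)
import Data.List.Relation.Unary.All as All
import Data.List.Relation.Unary.All.Properties as AllP
open import Data.Vec using (Vec; []; _∷_)
import Data.Vec as Vec
open import Data.Fin using (Fin; zero; suc; fromℕ<; opposite)
open import Relation.Binary.PropositionalEquality using (_≡_; refl; subst; sym)
open import Relation.Binary.Structures using (IsEquivalence)
open import Relation.Binary.Construct.Closure.ReflexiveTransitive using (Star)
open import Function.Bundles using (_↔_; Inverse)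
import Data.Vec.Relation.Binary.Pointwise.Inductive as VPW
import Data.List.Relation.Binary.Pointwise as LPW
import Data.Maybe.Relation.Binary.Pointwise as MPW

-- Register indices are natural numbers;
-- writing to an index >= the number of registers discards the value
-- (this is the paper's "-").

record Prog : Set where
  constructor prog
  field
    loads : List ℕ
    apps  : List (ℕ × ℕ × ℕ)     -- App i j k  is  (i , j , k)
    call  : Maybe ℕ

-- Static validity: which registers are initialised at each point.
Init : Set
Init = ℕ → Bool

setI : ℕ → ℕ → Init → Init
setI r k ι m = ((k <ᵇ r) ∧ (m ≡ᵇ k)) ∨ ι m

okI : ℕ → Init → ℕ → Bool
okI r ι i = (i <ᵇ r) ∧ ι i

loadAll : ℕ → Init → List ℕ → Init
loadAll r ι []       = ι
loadAll r ι (k ∷ ks) = loadAll r (setI r k ι) ks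

validCall : ℕ → Init → Maybe ℕ → Bool
validCall r ι nothing  = true
validCall r ι (just i) = okI r ι i

validApps : ℕ → Init → List (ℕ × ℕ × ℕ) → Maybe ℕ → Bool
validApps r ι []                c = validCall r ι c
validApps r ι ((i , j , k) ∷ as) c = okI r ι i ∧ (okI r ι j ∧ validApps r (setI r k ι) as c)

module _ {A : Set} where

  readR : ∀ {r} → Vec (Maybe A) r → ℕ → Maybe A
  readR []       _       = nothing
  readR (x ∷ xs) zero    = x
  readR (x ∷ xs) (suc i) = readR xs i

  write : ∀ {r} → ℕ → A → Vec (Maybe A) r → Vec (Maybe A) r
  write _       a []       = []
  write zero    a (_ ∷ xs) = just a ∷ xs
  write (suc i) a (x ∷ xs) = x ∷ write i a xs

  initOf : ∀ {r} → Vec (Maybe A) r → Init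
  initOf rs m = is-just (readR rs m)

  validMachine : (r : ℕ) → Vec (Maybe A) r → Prog → Bool
  validMachine r rs (prog ls as c) = validApps r (loadAll r (initOf rs) ls) as c

record Machine (A : Set) : Set where
  constructor mach
  field
    nregs   : ℕ
    regs    : Vec (Maybe A) nregs
    program : Prog
    tape    : List A
    valid   : T (validMachine nregs regs program)

_◂_ : ∀ {A} → Machine A → List A → Machine A
mach r rs p t v ◂ t' = mach r rs p (t ++ t') v

data Λ (A : Set) : Set where
  var : ℕ → Λ A
  con : A → Λ A
  app : Λ A → Λ A → Λ A
  lam : Λ A → Λ A

data _∈FV_ {A : Set} : ℕ → Λ A → Set where
  fv-var  : ∀ {x} → x ∈FV var x
  fv-appˡ : ∀ {x M N} → x ∈FV M → x ∈FV app M N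
  fv-appʳ : ∀ {x M N} → x ∈FV N → x ∈FV app M N
  fv-lam  : ∀ {x M} → suc x ∈FV M → x ∈FV lam M

fvb : ∀ {A} → Λ A → ℕ
fvb (var x)   = suc x
fvb (con a)   = 0
fvb (app M N) = fvb M ⊔ fvb N
fvb (lam M)   = pred (fvb M)

_∷ρ_ : ∀ {A : Set} → A → (ℕ → A) → (ℕ → A)
(a ∷ρ ρ) zero    = a
(a ∷ρ ρ) (suc x) = ρ x

-- lifting a relation on constants to terms (used for well-definedness
-- on the quotient Λ(A/≈))
data Λ-Rel {A : Set} (R : A → A → Set) : Λ A → Λ A → Set where
  var : ∀ x → Λ-Rel R (var x) (var x)
  con : ∀ {a b} → R a b → Λ-Rel R (con a) (con b)
  app : ∀ {M M' N N'} → Λ-Rel R M M' → Λ-Rel R N N' → Λ-Rel R (app M N) (app M' N')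
  lam : ∀ {M M'} → Λ-Rel R M M' → Λ-Rel R (lam M) (lam M')

-- Syntactic λ-model on the quotient A/≈, presented as a setoid:
-- all operations are on representatives and required to respect ≈.

record IsSyntacticλModel {A : Set} (_≈_ : A → A → Set) (_·_ : A → A → A)
                         (⟦_⟧_ : Λ A → (ℕ → A) → A) : Set where
  field
    isEquivalence : IsEquivalence _≈_
    ·-cong  : ∀ {a a' b b'} → a ≈ a' → b ≈ b' → (a · b) ≈ (a' · b')
    ⟦⟧-cong : ∀ {M N ρ ρ'} → Λ-Rel _≈_ M N → (∀ x → ρ x ≈ ρ' x) → (⟦ M ⟧ ρ) ≈ (⟦ N ⟧ ρ')
    ⟦var⟧   : ∀ x ρ → (⟦ var x ⟧ ρ) ≈ ρ x
    ⟦con⟧   : ∀ a ρ → (⟦ con a ⟧ ρ) ≈ a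
    ⟦app⟧   : ∀ P Q ρ → (⟦ app P Q ⟧ ρ) ≈ ((⟦ P ⟧ ρ) · (⟦ Q ⟧ ρ))
    ⟦lam⟧β  : ∀ P ρ a → ((⟦ lam P ⟧ ρ) · a) ≈ (⟦ P ⟧ (a ∷ρ ρ))
    ⟦⟧-fv   : ∀ M ρ ρ' → (∀ x → x ∈FV M → ρ x ≈ ρ' x) → (⟦ M ⟧ ρ) ≈ (⟦ M ⟧ ρ')
    ⟦lam⟧ξ  : ∀ M N ρ → (∀ a → (⟦ M ⟧ (a ∷ρ ρ)) ≈ (⟦ N ⟧ (a ∷ρ ρ)))
                      → (⟦ lam M ⟧ ρ) ≈ (⟦ lam N ⟧ ρ)

private
  ∧-intro : ∀ {a b} → T a → T b → T (a ∧ b)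
  ∧-intro {true} _ q = q

  ∨-introʳ : ∀ a {b} → T b → T (a ∨ b)
  ∨-introʳ true  _ = tt
  ∨-introʳ false q = q

  ∨-introˡ : ∀ {a} b → T a → T (a ∨ b)
  ∨-introˡ {true} b _ = tt

  okI-intro : ∀ r ι i → i < r → T (ι i) → T (okI r ι i)
  okI-intro r ι i i<r p = ∧-intro (<⇒<ᵇ i<r) p

  setI-here : ∀ r k ι → k < r → T (setI r k ι k)
  setI-here r k ι k<r = ∨-introˡ (ι k) (∧-intro (<⇒<ᵇ k<r) (≡⇒≡ᵇ k k refl))

  setI-mono : ∀ r k ι x → T (ι x) → T (setI r k ι x)
  setI-mono r k ι x p = ∨-introʳ ((k <ᵇ r) ∧ (x ≡ᵇ k)) p

  loadAll-mono : ∀ {r} ι ks x → T (ι x) → T (loadAll r ι ks x)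
  loadAll-mono ι []       x p = p
  loadAll-mono {r} ι (k ∷ ks) x p = loadAll-mono (setI r k ι) ks x (setI-mono r k ι x p)

  loadAll-dash : ∀ n ι → loadAll 1 ι (replicate n 1) ≡ ι
  loadAll-dash zero    ι = refl
  loadAll-dash (suc n) ι = loadAll-dash n ι

countFrom : ℕ → ℕ → List ℕ
countFrom k zero    = []
countFrom k (suc m) = k ∷ countFrom (suc k) m

private
  countFrom-loads : ∀ {r} k m ι → (∀ x → x < k → T (ι x)) → k + m ≤ r →
                    ∀ x → x < k + m → T (loadAll r ι (countFrom k m) x)
  countFrom-loads {r} k zero ι h _ x x<
    rewrite Data.Nat.Properties.+-identityʳ k = h x x<
  countFrom-loads {r} k (suc m) ι h le x x< =
    countFrom-loads (suc k) m (setI r k ι) h' (subst (_≤ r) (+-suc k m) le) x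
                    (subst (x <_) (+-suc k m) x<)
    where
    h' : ∀ y → y < suc k → T (setI r k ι y)
    h' y (s≤s y≤k) with Data.Nat.Properties.m≤n⇒m<n∨m≡n y≤k
    ... | inj₁ y<k  = setI-mono r k ι y (h y y<k)
    ... | inj₂ refl = setI-here r k ι (Data.Nat.Properties.<-≤-trans (Data.Nat.Properties.m<m+n k (s≤s z≤n)) le)

  countFrom-bound : ∀ k m → All (λ y → y < k + m) (countFrom k m)
  countFrom-bound k zero    = []
  countFrom-bound k (suc m) =
    Data.Nat.Properties.m<m+n k (s≤s z≤n) ∷
    All.map (λ {y} → subst (y <_) (sym (+-suc k m))) (countFrom-bound (suc k) m)

prLoads : (n : ℕ) → Fin n → List ℕ
prLoads (suc n) zero    = 0 ∷ replicate n 1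
prLoads (suc n) (suc p) = 1 ∷ prLoads n p

private
  pr-valid : ∀ n (p : Fin n) ι → T (validApps 1 (loadAll 1 ι (prLoads n p)) [] (just 0))
  pr-valid (suc n) zero ι rewrite loadAll-dash n (setI 1 0 ι) = tt
  pr-valid (suc n) (suc p) ι = pr-valid n p ι

  cons-valid : ∀ {A : Set} n (a : A) →
               T (validMachine 1 (just a ∷ []) (prog (replicate n 1) [] (just 0)))
  cons-valid n a rewrite loadAll-dash n (initOf (just a ∷ [])) = tt

-- Pr^n_p : one register; loads n tape entries, keeping only the p-th (0-based)
Pr : ∀ {A : Set} (n : ℕ) → Fin n → Machine A
Pr n p = mach 1 (nothing ∷ []) (prog (prLoads n p) [] (just 0)) [] (pr-valid n p _)

Cons : ∀ {A : Set} (n : ℕ) → A → Machine A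
Cons n a = mach 1 (just a ∷ []) (prog (replicate n 1) [] (just 0)) [] (cons-valid n a)

appRegs : ∀ {A : Set} (n : ℕ) → A → A → Vec (Maybe A) (n + 3)
appRegs n m q = Vec.replicate n nothing Vec.++ (just m ∷ just q ∷ nothing ∷ [])

applyProg : ℕ → Prog
applyProg n =
  prog (countFrom 0 n)
       ((map (λ i → (n , i , n)) (countFrom 0 n) ++
         map (λ i → (suc n , i , suc n)) (countFrom 0 n)) ++
        ((n , suc n , suc (suc n)) ∷ []))
       (just (suc (suc n)))

private
  lt0 : ∀ n → n < n + 3
  lt0 zero = s≤s z≤n
  lt0 (suc n) = s≤s (lt0 n)
  lt1 : ∀ n → suc n < n + 3
  lt1 zero = s≤s (s≤s z≤n)
  lt1 (suc n) = s≤s (lt1 n)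
  lt2 : ∀ n → suc (suc n) < n + 3
  lt2 zero = s≤s (s≤s (s≤s z≤n))
  lt2 (suc n) = s≤s (lt2 n)
  ltx : ∀ {y} n → y < n → y < n + 3
  ltx n y<n = Data.Nat.Properties.<-≤-trans y<n (m≤m+n n 3)

  initOf-pad : ∀ {A : Set} n {k} (ys : Vec (Maybe A) k) x →
               initOf (Vec.replicate n nothing Vec.++ ys) (n + x) ≡ initOf ys x
  initOf-pad zero    ys x = refl
  initOf-pad (suc n) ys x = initOf-pad n ys x

  Rd : ℕ → ℕ → Set
  Rd n y = y < n ⊎ (y ≡ n ⊎ y ≡ suc n)

  Inv : ℕ → Init → Set
  Inv n ι = ∀ y → Rd n y → T (ι y)

  Rd-lt : ∀ n y → Rd n y → y < n + 3
  Rd-lt n y (inj₁ y<n)        = ltx n y<n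
  Rd-lt n y (inj₂ (inj₁ refl)) = lt0 n
  Rd-lt n y (inj₂ (inj₂ refl)) = lt1 n

  RdT : ℕ → ℕ × ℕ × ℕ → Set
  RdT n (i , j , k) = Rd n i × Rd n j

  chain : ∀ n ι xs ys c → Inv n ι → All (RdT n) xs →
          (∀ ι' → Inv n ι' → T (validApps (n + 3) ι' ys c)) →
          T (validApps (n + 3) ι (xs ++ ys) c)
  chain n ι [] ys c inv [] k = k ι inv
  chain n ι ((i , j , l) ∷ xs) ys c inv ((ri , rj) ∷ rs) k =
    ∧-intro (okI-intro (n + 3) ι i (Rd-lt n i ri) (inv i ri))
      (∧-intro (okI-intro (n + 3) ι j (Rd-lt n j rj) (inv j rj))
        (chain n (setI (n + 3) l ι) xs ys c (λ y ry → setI-mono (n + 3) l ι y (inv y ry)) rs k))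

  lastOK : ∀ n ι → Inv n ι →
           T (validApps (n + 3) ι ((n , suc n , suc (suc n)) ∷ []) (just (suc (suc n))))
  lastOK n ι inv =
    ∧-intro (okI-intro (n + 3) ι n (lt0 n) (inv n (inj₂ (inj₁ refl))))
      (∧-intro (okI-intro (n + 3) ι (suc n) (lt1 n) (inv (suc n) (inj₂ (inj₂ refl))))
        (okI-intro (n + 3) (setI (n + 3) (suc (suc n)) ι) (suc (suc n)) (lt2 n) (setI-here (n + 3) (suc (suc n)) ι (lt2 n))))

  readsOK : ∀ n → All (RdT n)
              (map (λ i → (n , i , n)) (countFrom 0 n) ++
               map (λ i → (suc n , i , suc n)) (countFrom 0 n))
  readsOK n = AllP.++⁺
    (AllP.map⁺ (All.map (λ lt → inj₂ (inj₁ refl) , inj₁ lt) (countFrom-bound 0 n)))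
    (AllP.map⁺ (All.map (λ lt → inj₂ (inj₂ refl) , inj₁ lt) (countFrom-bound 0 n)))

  app-valid : ∀ {A : Set} n (m q : A) → T (validMachine (n + 3) (appRegs n m q) (applyProg n))
  app-valid {A} n m q =
    chain n ι1 _ _ _ inv1 (readsOK n) (λ ι' inv' → lastOK n ι' inv')
    where
    ι0 = initOf (appRegs n m q)
    ι1 = loadAll (n + 3) ι0 (countFrom 0 n)
    h0 : T (ι0 n)
    h0 = subst T (sym (subst (λ z → initOf (appRegs n m q) z ≡ true)
                         (Data.Nat.Properties.+-identityʳ n)
                         (initOf-pad n (just m ∷ just q ∷ nothing ∷ []) 0))) tt
    h1 : T (ι0 (suc n))
    h1 = subst T (sym (subst (λ z → initOf (appRegs n m q) z ≡ true)
                         (trans' n)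
                         (initOf-pad n (just m ∷ just q ∷ nothing ∷ []) 1))) tt
      where
      trans' : ∀ n → n + 1 ≡ suc n
      trans' n = Data.Nat.Properties.+-comm n 1
    inv1 : Inv n ι1
    inv1 y (inj₁ y<n) = countFrom-loads 0 n ι0 (λ _ ()) (m≤m+n n 3) y y<n
    inv1 y (inj₂ (inj₁ refl)) = loadAll-mono ι0 (countFrom 0 n) y h0
    inv1 y (inj₂ (inj₂ refl)) = loadAll-mono ι0 (countFrom 0 n) y h1

AppM : ∀ {A : Set} (n : ℕ) → A → A → Machine A
AppM n m q = mach (n + 3) (appRegs n m q) (applyProg n) [] (app-valid n m q)

module AddressingMachines {A : Set} (enc : Machine A ↔ A) where

  # : Machine A → A
  # = Inverse.to enc

  #⁻¹ : A → Machine A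
  #⁻¹ = Inverse.from enc

  _·_ : A → A → A
  a · b = # (#⁻¹ a ◂ (b ∷ []))

  -- head reduction (one step); the validity proof of the target is
  -- arbitrary (validity is a proposition)
  data _→h_ : Machine A → Machine A → Set where
    h-load : ∀ {r rs i ls as c a t v v'} →
             mach r rs (prog (i ∷ ls) as c) (a ∷ t) v →h mach r (write i a rs) (prog ls as c) t v'
    h-app  : ∀ {r rs i j k as c t x y v v'} → readR rs i ≡ just x → readR rs j ≡ just y →
             mach r rs (prog [] ((i , j , k) ∷ as) c) t v →h mach r (write k (x · y) rs) (prog [] as c) t v'
    h-call : ∀ {r rs i t v x} → readR rs i ≡ just x →
             mach r rs (prog [] [] (just i)) t v →h (#⁻¹ x ◂ t)

  _↠h_ : Machine A → Machine A → Set
  _↠h_ = Star _→h_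

  data Stuck : Machine A → Set where
    stuck : ∀ {r rs i ls as c v} → Stuck (mach r rs (prog (i ∷ ls) as c) [] v)

  _↠stuck : Machine A → Set
  M ↠stuck = Σ' M
    where
    Σ' : Machine A → Set
    Σ' M = Data.Product.Σ (Machine A) (λ Z → (M ↠h Z) × Stuck Z)

  mutual
    data _≡ae_ : Machine A → Machine A → Set where
      ae-refl  : ∀ {M} → M ≡ae M
      ae-sym   : ∀ {M N} → M ≡ae N → N ≡ae M
      ae-trans : ∀ {M N L} → M ≡ae N → N ≡ae L → M ≡ae L
      ae-red   : ∀ {M Z N} → M ↠h Z → Z =ae N → M ≡ae N
      ae-ext   : ∀ {M N} → M ↠stuck → N ↠stuck →
                 (∀ a → (M ◂ (a ∷ [])) ≡ae (N ◂ (a ∷ []))) → M ≡ae N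

    _≃ae_ : A → A → Set
    a ≃ae b = #⁻¹ a ≡ae #⁻¹ b

    data _=ae_ : Machine A → Machine A → Set where
      ae-struct : ∀ {r rs rs' p t t' v v'} →
                  VPW.Pointwise (MPW.Pointwise _≃ae_) rs rs' →
                  LPW.Pointwise _≃ae_ t t' →
                  mach r rs p t v =ae mach r rs' p t' v'

  -- the machine [M]_n, for M with free indices < n.  De Bruijn index k
  -- corresponds to the variable x_{n-k} of x_1 … x_n, i.e. 0-based tape
  -- position  opposite k.
  private
    pred≤ : ∀ {m n} → pred m ≤ n → m ≤ suc n
    pred≤ {zero}  _ = z≤n
    pred≤ {suc m} p = s≤s p

  mach⟦_⟧ : (n : ℕ) (M : Λ A) → fvb M ≤ n → Machine A
  mach⟦ n ⟧ (var k)   p = Pr n (opposite (fromℕ< p))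
  mach⟦ n ⟧ (con a)   p = Cons n a
  mach⟦ n ⟧ (app M N) p = AppM n (# (mach⟦ n ⟧ M (m⊔n≤o⇒m≤o (fvb M) (fvb N) p)))
                                 (# (mach⟦ n ⟧ N (m⊔n≤o⇒n≤o (fvb M) (fvb N) p)))
  mach⟦ n ⟧ (lam M)   p = mach⟦ suc n ⟧ M (pred≤ p)

  ⟦_⟧_ : Λ A → (ℕ → A) → A
  ⟦ M ⟧ ρ = # (mach⟦ fvb M ⟧ M ≤-refl ◂ map ρ (downFrom (fvb M)))

{-# OPTIONS --safe #-}
-- The projection, constant and application machines reduce to
-- #⁻¹ (ρ x), to #⁻¹ a and to the first sub-machine applied to the result of
-- the second, while the machine of an abstraction is stuck waiting for one more
-- argument, so two of them are compared by rule (2) on every further argument.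
-- By induction on terms the resulting machine depends, up to ≡ae, only on the
-- term up to ≃ae and on ρ on the free variables, and not on the length of the
-- context; each law of a syntactic λ-model is a consequence of these facts.
module Submission where

open import Defs
open import Data.Nat using (ℕ; zero; suc; _+_; _∸_; _≤_; _<_; _<ᵇ_; _≡ᵇ_; z≤n; s≤s)
import Data.Nat.Properties as ℕ
open import Data.Bool using (T; _∧_)
open import Data.Bool.Properties using (T-∧; T-∨)
open import Data.Unit using (tt)
open import Data.Maybe using (Maybe; just; nothing; is-just)
open import Data.Product using (Σ; _×_; _,_; proj₂)
open import Data.Sum using (inj₁; inj₂)
open import Data.List using (List; []; _∷_; _++_; map; replicate; downFrom; foldl; length)
import Data.List.Properties as List
open import Data.Vec using (Vec; []; _∷_; toList; lookup)
import Data.Vec as Vec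
import Data.Vec.Properties as Vec
open import Data.Fin using (Fin; zero; suc; toℕ; fromℕ<; opposite)
import Data.Fin.Properties as Fin
open import Function.Bundles using (_↔_; _↣_; Inverse; Equivalence)
open import Relation.Binary.PropositionalEquality
open import Relation.Binary.Construct.Closure.ReflexiveTransitive using (ε; _◅_; gmap)
import Data.Vec.Relation.Binary.Pointwise.Inductive as VPW
import Data.List.Relation.Binary.Pointwise as LPW
import Data.Maybe.Relation.Binary.Pointwise as MPW

T-∧-split : ∀ x {y} → T (x ∧ y) → T x × T y
T-∧-split x = Equivalence.to (T-∧ {x})

_⊆ᴵ_ : Init → Init → Set
ι ⊆ᴵ ι' = ∀ m → T (ι m) → T (ι' m)

setI-mono : ∀ r k {ι ι'} → ι ⊆ᴵ ι' → setI r k ι ⊆ᴵ setI r k ι'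
setI-mono r k ι⊆ι' m h with Equivalence.to T-∨ h
... | inj₁ new = Equivalence.from T-∨ (inj₁ new)
... | inj₂ old = Equivalence.from (T-∨ {(k <ᵇ r) ∧ (m ≡ᵇ k)}) (inj₂ (ι⊆ι' m old))

okI-mono : ∀ r {ι ι'} → ι ⊆ᴵ ι' → ∀ i → T (okI r ι i) → T (okI r ι' i)
okI-mono r ι⊆ι' i h with T-∧-split (i <ᵇ r) h
... | i<r , init = Equivalence.from T-∧ (i<r , ι⊆ι' i init)

loadAll-mono : ∀ r ls {ι ι'} → ι ⊆ᴵ ι' → loadAll r ι ls ⊆ᴵ loadAll r ι' ls
loadAll-mono r []       ι⊆ι' = ι⊆ι'
loadAll-mono r (k ∷ ls) ι⊆ι' = loadAll-mono r ls (setI-mono r k ι⊆ι')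

validApps-mono : ∀ r as c {ι ι'} → ι ⊆ᴵ ι' → T (validApps r ι as c) → T (validApps r ι' as c)
validApps-mono r [] nothing  ι⊆ι' h = tt
validApps-mono r [] (just i) ι⊆ι' h = okI-mono r ι⊆ι' i h
validApps-mono r ((i , j , k) ∷ as) c {ι} ι⊆ι' h with T-∧-split (okI r ι i) h
... | ok-i , rest with T-∧-split (okI r ι j) rest
... | ok-j , valid =
  Equivalence.from T-∧ (okI-mono r ι⊆ι' i ok-i , Equivalence.from T-∧
    (okI-mono r ι⊆ι' j ok-j , validApps-mono r as c (setI-mono r k ι⊆ι') valid))

module _ {A : Set} where

  just-witness : {m : Maybe A} → T (is-just m) → Σ A λ x → m ≡ just x
  just-witness {just x} _ = x , refl

  readR-write-≡ : ∀ {r} k (a : A) (rs : Vec (Maybe A) r) → k < r → readR (write k a rs) k ≡ just a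
  readR-write-≡ zero    a (x ∷ rs) _         = refl
  readR-write-≡ (suc k) a (x ∷ rs) (s≤s k<r) = readR-write-≡ k a rs k<r

  is-just-write : ∀ {r} k (a : A) (rs : Vec (Maybe A) r) y →
                  T (is-just (readR rs y)) → T (is-just (readR (write k a rs) y))
  is-just-write k       a []       y       h = h
  is-just-write zero    a (x ∷ rs) zero    h = tt
  is-just-write zero    a (x ∷ rs) (suc y) h = h
  is-just-write (suc k) a (x ∷ rs) zero    h = h
  is-just-write (suc k) a (x ∷ rs) (suc y) h = is-just-write k a rs y h

  setI⊆initOf-write : ∀ {r} k (a : A) (rs : Vec (Maybe A) r) → setI r k (initOf rs) ⊆ᴵ initOf (write k a rs)
  setI⊆initOf-write {r} k a rs m h with Equivalence.to T-∨ h
  ... | inj₂ old = is-just-write k a rs m old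
  ... | inj₁ new with T-∧-split (k <ᵇ r) new
  ... | k<ᵇr , m≡ᵇk with ℕ.≡ᵇ⇒≡ m k m≡ᵇk
  ... | refl = subst (λ x → T (is-just x)) (sym (readR-write-≡ k a rs (ℕ.<ᵇ⇒< k r k<ᵇr))) tt

  valid-load : ∀ {r rs i ls as c} (a : A) → T (validMachine r rs (prog (i ∷ ls) as c)) →
               T (validMachine r (write i a rs) (prog ls as c))
  valid-load {r} {rs} {i} {ls} {as} {c} a =
    validApps-mono r as c (loadAll-mono r ls (setI⊆initOf-write i a rs))

  valid-reads : ∀ {r rs i j k as c} → T (validMachine {A} r rs (prog [] ((i , j , k) ∷ as) c)) →
                T (is-just (readR rs i)) × T (is-just (readR rs j))
  valid-reads {r} {rs} {i} {j} v =
    let ok-i , rest = T-∧-split (okI r (initOf rs) i) v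
        ok-j , _    = T-∧-split (okI r (initOf rs) j) rest
    in proj₂ (T-∧-split (i <ᵇ r) ok-i) , proj₂ (T-∧-split (j <ᵇ r) ok-j)

  valid-app : ∀ {r rs i j k as c} (a : A) → T (validMachine r rs (prog [] ((i , j , k) ∷ as) c)) →
              T (validMachine r (write k a rs) (prog [] as c))
  valid-app {r} {rs} {i} {j} {k} {as} {c} a v =
    let _ , rest  = T-∧-split (okI r (initOf rs) i) v
        _ , valid = T-∧-split (okI r (initOf rs) j) rest
    in validApps-mono r as c (setI⊆initOf-write k a rs) valid

length-prLoads : ∀ {n} (p : Fin n) → length (prLoads n p) ≡ n
length-prLoads {suc n} zero    = cong suc (List.length-replicate n)
length-prLoads         (suc p) = cong suc (length-prLoads p)

countFrom-suc : ∀ k n → countFrom (suc k) n ≡ map suc (countFrom k n)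
countFrom-suc k zero    = refl
countFrom-suc k (suc n) = cong (suc k ∷_) (countFrom-suc (suc k) n)

length-countFrom : ∀ k n → length (countFrom k n) ≡ n
length-countFrom k zero    = refl
length-countFrom k (suc n) = cong suc (length-countFrom (suc k) n)

module _ {A : Set} where

  writes : ∀ {r} → List ℕ → List A → Vec (Maybe A) r → Vec (Maybe A) r
  writes []       _        rs = rs
  writes (_ ∷ _)  []       rs = rs
  writes (i ∷ ls) (a ∷ xs) rs = writes ls xs (write i a rs)

  writes-discarded : ∀ n xs (y : Maybe A) → writes (replicate n 1) xs (y ∷ []) ≡ y ∷ []
  writes-discarded zero    xs       y = refl
  writes-discarded (suc n) []       y = refl
  writes-discarded (suc n) (a ∷ xs) y = writes-discarded n xs y

  writes-prLoads : ∀ {n} (p : Fin n) (u : Vec A n) y →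
                   writes (prLoads n p) (toList u) (y ∷ []) ≡ just (lookup u p) ∷ []
  writes-prLoads {suc n} zero    (a ∷ u) y = writes-discarded n (toList u) (just a)
  writes-prLoads         (suc p) (a ∷ u) y = writes-prLoads p u y

  writes-shift : ∀ {r} ls xs (y : Maybe A) (rs : Vec (Maybe A) r) →
                 writes (map suc ls) xs (y ∷ rs) ≡ y ∷ writes ls xs rs
  writes-shift []       xs       y rs = refl
  writes-shift (_ ∷ _)  []       y rs = refl
  writes-shift (i ∷ ls) (a ∷ xs) y rs = writes-shift ls xs y (write i a rs)

  writes-countFrom : ∀ {n k} (u : Vec A n) (ys : Vec (Maybe A) k) →
                     writes (countFrom 0 n) (toList u) (Vec.replicate n nothing Vec.++ ys) ≡ Vec.map just u Vec.++ ys
  writes-countFrom {suc n} (a ∷ u) ys = begin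
    writes (countFrom 1 n) (toList u) (just a ∷ (Vec.replicate n nothing Vec.++ ys))
      ≡⟨ cong (λ ls → writes ls (toList u) (just a ∷ (Vec.replicate n nothing Vec.++ ys))) (countFrom-suc 0 n) ⟩
    writes (map suc (countFrom 0 n)) (toList u) (just a ∷ (Vec.replicate n nothing Vec.++ ys))
      ≡⟨ writes-shift (countFrom 0 n) (toList u) (just a) _ ⟩
    just a ∷ writes (countFrom 0 n) (toList u) (Vec.replicate n nothing Vec.++ ys)
      ≡⟨ cong (just a ∷_) (writes-countFrom u ys) ⟩
    just a ∷ (Vec.map just u Vec.++ ys) ∎
    where open ≡-Reasoning
  writes-countFrom {zero} [] ys = refl

  readR-++ : ∀ {n k} (vs : Vec (Maybe A) n) {ys : Vec (Maybe A) k} {o t} →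
             t ≡ n + o → readR (vs Vec.++ ys) t ≡ readR ys o
  readR-++ []       refl = refl
  readR-++ (v ∷ vs) refl = readR-++ vs refl

  write-++ : ∀ {n k} (vs : Vec (Maybe A) n) {ys : Vec (Maybe A) k} {o t} b →
             t ≡ n + o → write t b (vs Vec.++ ys) ≡ vs Vec.++ write o b ys
  write-++ []       b refl = refl
  write-++ (v ∷ vs) b refl = cong (v ∷_) (write-++ vs b refl)

  write-write : ∀ {k} o (b c : A) (ys : Vec (Maybe A) k) → write o b (write o c ys) ≡ write o b ys
  write-write o       b c []       = refl
  write-write zero    b c (y ∷ ys) = refl
  write-write (suc o) b c (y ∷ ys) = cong (y ∷_) (write-write o b c ys)

  args : ℕ → (ℕ → A) → List A
  args n ρ = map ρ (downFrom n)

  env : (n : ℕ) → (ℕ → A) → Vec A n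
  env zero    ρ = []
  env (suc n) ρ = ρ n ∷ env n ρ

  toList-env : ∀ n ρ → toList (env n ρ) ≡ args n ρ
  toList-env zero    ρ = refl
  toList-env (suc n) ρ = cong (ρ n ∷_) (toList-env n ρ)

  args-env : ∀ n (ρ : ℕ → A) → toList (env n ρ) ++ [] ≡ args n ρ
  args-env n ρ = trans (List.++-identityʳ _) (toList-env n ρ)

  length-args : ∀ n ρ → length (args n ρ) ≡ n
  length-args n ρ = trans (List.length-map ρ (downFrom n)) (List.length-downFrom n)

  args-snoc : ∀ n ρ (a : A) → args n ρ ++ (a ∷ []) ≡ args (suc n) (a ∷ρ ρ)
  args-snoc zero    ρ a = refl
  args-snoc (suc n) ρ a = cong (ρ n ∷_) (args-snoc n ρ a)

  lookup-env : ∀ {n} (i : Fin n) ρ → lookup (env n ρ) i ≡ ρ (n ∸ suc (toℕ i))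
  lookup-env {suc n} zero    ρ = refl
  lookup-env {suc n} (suc i) ρ = lookup-env i ρ

  lookup-env-opposite : ∀ {n} (i : Fin n) ρ → lookup (env n ρ) (opposite i) ≡ ρ (toℕ i)
  lookup-env-opposite i ρ = trans (lookup-env (opposite i) ρ)
    (cong ρ (trans (sym (Fin.opposite-prop (opposite i))) (cong toℕ (Fin.opposite-involutive i))))

module Interpretation {A : Set} (enc : Machine A ↔ A) where
  open AddressingMachines enc

  -- On valid machines both operands are always initialised, so the fallback
  -- clause of writeApp is never used by head reduction.
  writeApp : ∀ {r} → ℕ → Maybe A → Maybe A → Vec (Maybe A) r → Vec (Maybe A) r
  writeApp k (just x) (just y) rs = write k (x · y) rs
  writeApp k _        _        rs = rs

  runApps : ∀ {r} → List (ℕ × ℕ × ℕ) → Vec (Maybe A) r → Vec (Maybe A) r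
  runApps []                 rs = rs
  runApps ((i , j , k) ∷ as) rs = runApps as (writeApp k (readR rs i) (readR rs j) rs)

  loads-↠h : ∀ {r rs ls as c t v N} xs → length xs ≡ length ls →
             (∀ v' → mach r (writes ls xs rs) (prog [] as c) t v' ↠h N) →
             mach r rs (prog ls as c) (xs ++ t) v ↠h N
  loads-↠h {ls = []}     []       _   continue = continue _
  loads-↠h {r} {rs} {i ∷ ls} {as} {c} {v = v} (a ∷ xs) len continue =
    h-load {v' = valid-load {A} {r} {rs} {i} {ls} {as} {c} a v} ◅ loads-↠h xs (ℕ.suc-injective len) continue

  apps-↠h : ∀ {r rs} as {c t v N} → (∀ v' → mach r (runApps as rs) (prog [] [] c) t v' ↠h N) →
            mach r rs (prog [] as c) t v ↠h N
  apps-↠h [] continue = continue _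
  apps-↠h {r} {rs} ((i , j , k) ∷ as) {c} {t} {v} {N} continue
    with valid-reads {A} {r} {rs} {i} {j} {k} {as} {c} v
  ... | init-i , init-j with just-witness init-i | just-witness init-j
  ... | x , rsᵢ≡x | y , rsⱼ≡y =
    h-app {v' = valid-app {A} {r} {rs} {i} {j} {k} {as} {c} (x · y) v} rsᵢ≡x rsⱼ≡y
      ◅ apps-↠h as (subst After (cong₂ (λ p q → writeApp k p q rs) rsᵢ≡x rsⱼ≡y) continue)
    where
    After : Vec (Maybe A) r → Set
    After rs' = ∀ v' → mach r (runApps as rs') (prog [] [] c) t v' ↠h N

  run-↠h : ∀ {r rs ls as i t v x} xs → length xs ≡ length ls →
           readR (runApps as (writes ls xs rs)) i ≡ just x →
           mach r rs (prog ls as (just i)) (xs ++ t) v ↠h (#⁻¹ x ◂ t)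
  run-↠h xs len called = loads-↠h xs len λ _ → apps-↠h _ λ _ → h-call called ◅ ε

  loads-↠stuck : ∀ {r rs ls as c v} xs → length xs < length ls → mach r rs (prog ls as c) xs v ↠stuck
  loads-↠stuck {ls = _ ∷ _} [] _ = _ , ε , stuck
  loads-↠stuck {r} {rs} {i ∷ ls} {as} {c} {v} (a ∷ xs) (s≤s short) =
    let Z , M↠Z , Z-stuck = loads-↠stuck xs short
    in Z , h-load {v' = valid-load {A} {r} {rs} {i} {ls} {as} {c} a v} ◅ M↠Z , Z-stuck

  shiftApp : ℕ × ℕ × ℕ → ℕ × ℕ × ℕ
  shiftApp (i , j , k) = suc i , suc j , suc k

  runApps-shift : ∀ {r} as y (rs : Vec (Maybe A) r) → runApps (map shiftApp as) (y ∷ rs) ≡ y ∷ runApps as rs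
  runApps-shift []                 y rs = refl
  runApps-shift ((i , j , k) ∷ as) y rs with readR rs i | readR rs j
  ... | just x  | just z  = runApps-shift as y (write k (x · z) rs)
  ... | just x  | nothing = runApps-shift as y rs
  ... | nothing | _       = runApps-shift as y rs

  runApps-++ : ∀ {r} as bs (rs : Vec (Maybe A) r) → runApps (as ++ bs) rs ≡ runApps bs (runApps as rs)
  runApps-++ []                 bs rs = refl
  runApps-++ ((i , j , k) ∷ as) bs rs = runApps-++ as bs _

  accumulateFrom : ℕ → ℕ → ℕ → List (ℕ × ℕ × ℕ)
  accumulateFrom t k n = map (λ i → t , i , t) (countFrom k n)

  accumulateFrom-suc : ∀ t k n → accumulateFrom (suc t) (suc k) n ≡ map shiftApp (accumulateFrom t k n)
  accumulateFrom-suc t k zero    = refl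
  accumulateFrom-suc t k (suc n) = cong (_ ∷_) (accumulateFrom-suc t (suc k) n)

  -- The index equation t ≡ n + o lets this apply to the literal targets n and suc n of applyProg.
  runApps-accumulate : ∀ {n k} (u : Vec A n) {ys : Vec (Maybe A) k} {o t} acc → t ≡ n + o → o < k →
    runApps (accumulateFrom t 0 n) (Vec.map just u Vec.++ write o acc ys)
      ≡ Vec.map just u Vec.++ write o (foldl _·_ acc (toList u)) ys
  runApps-accumulate []                   acc refl o<k = refl
  runApps-accumulate {suc n} (a ∷ u) {ys} {o} acc refl o<k = begin
    runApps rest (writeApp (suc (n + o)) (readR R (n + o)) (just a) (just a ∷ R))
      ≡⟨ cong (λ m → runApps rest (writeApp (suc (n + o)) m (just a) (just a ∷ R)))
              (trans (readR-++ us refl) (readR-write-≡ o acc ys o<k)) ⟩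
    runApps rest (just a ∷ write (n + o) (acc · a) R)
      ≡⟨ cong (λ rs → runApps rest (just a ∷ rs))
              (trans (write-++ us (acc · a) refl) (cong (us Vec.++_) (write-write o (acc · a) acc ys))) ⟩
    runApps rest (just a ∷ R')
      ≡⟨ cong (λ as → runApps as (just a ∷ R')) (accumulateFrom-suc (n + o) 0 n) ⟩
    runApps (map shiftApp (accumulateFrom (n + o) 0 n)) (just a ∷ R')
      ≡⟨ runApps-shift (accumulateFrom (n + o) 0 n) (just a) R' ⟩
    just a ∷ runApps (accumulateFrom (n + o) 0 n) R'
      ≡⟨ cong (just a ∷_) (runApps-accumulate u (acc · a) refl o<k) ⟩
    just a ∷ (us Vec.++ write o (foldl _·_ (acc · a) (toList u)) ys) ∎
    where
    open ≡-Reasoning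
    us = Vec.map just u
    rest = accumulateFrom (suc (n + o)) 1 n
    R = us Vec.++ write o acc ys
    R' = us Vec.++ write o (acc · a) ys

  runApps-applyProg : ∀ {n} (u : Vec A n) m q →
    let F = foldl _·_ m (toList u)
        G = foldl _·_ q (toList u)
    in runApps (Prog.apps (applyProg n)) (Vec.map just u Vec.++ (just m ∷ just q ∷ nothing ∷ []))
         ≡ Vec.map just u Vec.++ (just F ∷ just G ∷ just (F · G) ∷ [])
  runApps-applyProg {n} u m q = begin
    runApps ((accumulateFrom n 0 n ++ accumulateFrom (suc n) 0 n) ++ final) R₀
      ≡⟨ runApps-++ (accumulateFrom n 0 n ++ accumulateFrom (suc n) 0 n) final R₀ ⟩
    runApps final (runApps (accumulateFrom n 0 n ++ accumulateFrom (suc n) 0 n) R₀)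
      ≡⟨ cong (runApps final) (runApps-++ (accumulateFrom n 0 n) (accumulateFrom (suc n) 0 n) R₀) ⟩
    runApps final (runApps (accumulateFrom (suc n) 0 n) (runApps (accumulateFrom n 0 n) R₀))
      ≡⟨ cong (λ rs → runApps final (runApps (accumulateFrom (suc n) 0 n) rs))
              (runApps-accumulate u {just m ∷ just q ∷ nothing ∷ []} m (sym (ℕ.+-identityʳ n)) (s≤s z≤n)) ⟩
    runApps final (runApps (accumulateFrom (suc n) 0 n) (us Vec.++ (just F ∷ just q ∷ nothing ∷ [])))
      ≡⟨ cong (runApps final) (runApps-accumulate u {just F ∷ just q ∷ nothing ∷ []} q (sym (ℕ.+-comm n 1)) (s≤s (s≤s z≤n))) ⟩
    writeApp (suc (suc n)) (readR R₂ n) (readR R₂ (suc n)) R₂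
      ≡⟨ cong₂ (λ x y → writeApp (suc (suc n)) x y R₂)
               (readR-++ us (sym (ℕ.+-identityʳ n))) (readR-++ us (sym (ℕ.+-comm n 1))) ⟩
    write (suc (suc n)) (F · G) R₂
      ≡⟨ write-++ us (F · G) (sym (ℕ.+-comm n 2)) ⟩
    us Vec.++ (just F ∷ just G ∷ just (F · G) ∷ []) ∎
    where
    open ≡-Reasoning
    us = Vec.map just u
    F = foldl _·_ m (toList u)
    G = foldl _·_ q (toList u)
    final = (n , suc n , suc (suc n)) ∷ []
    R₀ = us Vec.++ (just m ∷ just q ∷ nothing ∷ [])
    R₂ = us Vec.++ (just F ∷ just G ∷ nothing ∷ [])

  Pr-↠h : ∀ {n} (p : Fin n) (u : Vec A n) t → (Pr n p ◂ (toList u ++ t)) ↠h (#⁻¹ (lookup u p) ◂ t)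
  Pr-↠h p u t = run-↠h (toList u) (trans (Vec.length-toList u) (sym (length-prLoads p)))
                       (cong (λ rs → readR rs 0) (writes-prLoads p u nothing))

  Cons-↠h : ∀ {n} a (u : Vec A n) t → (Cons n a ◂ (toList u ++ t)) ↠h (#⁻¹ a ◂ t)
  Cons-↠h {n} a u t = run-↠h (toList u) (trans (Vec.length-toList u) (sym (List.length-replicate n)))
                             (cong (λ rs → readR rs 0) (writes-discarded n (toList u) (just a)))

  AppM-↠h : ∀ {n} (u : Vec A n) m q t →
            (AppM n m q ◂ (toList u ++ t)) ↠h (#⁻¹ (foldl _·_ m (toList u) · foldl _·_ q (toList u)) ◂ t)
  AppM-↠h {n} u m q t = run-↠h (toList u) (trans (Vec.length-toList u) (sym (length-countFrom 0 n))) (begin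
    readR (runApps (Prog.apps (applyProg n)) (writes (countFrom 0 n) (toList u) (appRegs n m q))) (suc (suc n))
      ≡⟨ cong (λ rs → readR (runApps (Prog.apps (applyProg n)) rs) (suc (suc n))) (writes-countFrom u _) ⟩
    readR (runApps (Prog.apps (applyProg n)) (Vec.map just u Vec.++ (just m ∷ just q ∷ nothing ∷ []))) (suc (suc n))
      ≡⟨ cong (λ rs → readR rs (suc (suc n))) (runApps-applyProg u m q) ⟩
    readR (Vec.map just u Vec.++ (_ ∷ _ ∷ just (foldl _·_ m (toList u) · foldl _·_ q (toList u)) ∷ [])) (suc (suc n))
      ≡⟨ readR-++ (Vec.map just u) (sym (ℕ.+-comm n 2)) ⟩
    just (foldl _·_ m (toList u) · foldl _·_ q (toList u)) ∎)
    where open ≡-Reasoning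

  #⁻¹∘# : ∀ M → #⁻¹ (# M) ≡ M
  #⁻¹∘# = Inverse.strictlyInverseʳ enc

  #⁻¹-· : ∀ a b → #⁻¹ (a · b) ≡ #⁻¹ a ◂ (b ∷ [])
  #⁻¹-· a b = #⁻¹∘# _

  ◂-assoc : ∀ (M : Machine A) s t → (M ◂ s) ◂ t ≡ M ◂ (s ++ t)
  ◂-assoc (mach r rs p t₀ v) s t = cong (λ t' → mach r rs p t' v) (List.++-assoc t₀ s t)

  ◂-identityʳ : ∀ (M : Machine A) → M ◂ [] ≡ M
  ◂-identityʳ (mach r rs p t v) = cong (λ t' → mach r rs p t' v) (List.++-identityʳ t)

  foldl-·-# : ∀ X xs → foldl _·_ (# X) xs ≡ # (X ◂ xs)
  foldl-·-# X []       = cong # (sym (◂-identityʳ X))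
  foldl-·-# X (x ∷ xs) = begin
    foldl _·_ (# X · x) xs                  ≡⟨ cong (λ M → foldl _·_ (# (M ◂ (x ∷ []))) xs) (#⁻¹∘# X) ⟩
    foldl _·_ (# (X ◂ (x ∷ []))) xs         ≡⟨ foldl-·-# (X ◂ (x ∷ [])) xs ⟩
    # ((X ◂ (x ∷ [])) ◂ xs)                 ≡⟨ cong # (◂-assoc X (x ∷ []) xs) ⟩
    # (X ◂ (x ∷ xs))                        ∎
    where open ≡-Reasoning

  ◂-step : ∀ t {M N} → M →h N → (M ◂ t) →h (N ◂ t)
  ◂-step t (h-load {v' = v'})       = h-load {v' = v'}
  ◂-step t (h-app {v' = v'} eᵢ eⱼ)   = h-app {v' = v'} eᵢ eⱼ
  ◂-step t (h-call {t = t₀} {x = x} e) = subst (_ →h_) (sym (◂-assoc (#⁻¹ x) t₀ t)) (h-call e)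

  ◂-↠h : ∀ t {M N} → M ↠h N → (M ◂ t) ↠h (N ◂ t)
  ◂-↠h t = gmap (_◂ t) (◂-step t)

  ◂-↠stuck : ∀ (X : Machine A) xs → Machine.tape X ≡ [] → length xs < length (Prog.loads (Machine.program X)) →
             (X ◂ xs) ↠stuck
  ◂-↠stuck (mach r rs (prog ls as c) [] v) xs refl short = loads-↠stuck xs short

  =ae-refl : ∀ (M : Machine A) → M =ae M
  =ae-refl (mach r rs p t v) = ae-struct (VPW.refl (MPW.refl ae-refl)) (LPW.refl ae-refl)

  ≡⇒≡ae : ∀ {M N} → M ≡ N → M ≡ae N
  ≡⇒≡ae refl = ae-refl

  ↠h⇒≡ae : ∀ {M N} → M ↠h N → M ≡ae N
  ↠h⇒≡ae {N = N} M↠N = ae-red M↠N (=ae-refl N)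

  ◂-≡ae : ∀ t {M N} → M ≡ae N → (M ◂ t) ≡ae (N ◂ t)
  ◂-≡ae t ae-refl                  = ae-refl
  ◂-≡ae t (ae-sym N≡M)             = ae-sym (◂-≡ae t N≡M)
  ◂-≡ae t (ae-trans M≡L L≡N)       = ae-trans (◂-≡ae t M≡L) (◂-≡ae t L≡N)
  ◂-≡ae t (ae-red M↠Z (ae-struct rs≃ t≃)) = ae-red (◂-↠h t M↠Z) (ae-struct rs≃ (LPW.++⁺ t≃ (LPW.refl ae-refl)))
  ◂-≡ae [] {M} {N} M≡N@(ae-ext _ _ _) =
    ae-trans (≡⇒≡ae (◂-identityʳ M)) (ae-trans M≡N (≡⇒≡ae (sym (◂-identityʳ N))))
  ◂-≡ae (a ∷ t) {M} {N} (ae-ext _ _ M◂a≡N◂a) =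
    ae-trans (≡⇒≡ae (sym (◂-assoc M (a ∷ []) t)))
      (ae-trans (◂-≡ae t (M◂a≡N◂a a)) (≡⇒≡ae (◂-assoc N (a ∷ []) t)))

  ◂-cong : ∀ {M N a b} → M ≡ae N → a ≃ae b → (M ◂ (a ∷ [])) ≡ae (N ◂ (b ∷ []))
  ◂-cong {N = mach r rs p t v} M≡N a≃b =
    ae-trans (◂-≡ae (_ ∷ []) M≡N)
      (ae-red ε (ae-struct (VPW.refl (MPW.refl ae-refl)) (LPW.++⁺ (LPW.refl ae-refl) (a≃b LPW.∷ LPW.[]))))

  #-cong : ∀ {X Y} → X ≡ae Y → # X ≃ae # Y
  #-cong {X} {Y} X≡Y = subst₂ _≡ae_ (sym (#⁻¹∘# X)) (sym (#⁻¹∘# Y)) X≡Y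

  #-≃ae : ∀ {X b} → X ≡ae #⁻¹ b → # X ≃ae b
  #-≃ae {X} = subst (_≡ae _) (sym (#⁻¹∘# X))

  ·-cong : ∀ {a a' b b'} → a ≃ae a' → b ≃ae b' → (a · b) ≃ae (a' · b')
  ·-cong a≃a' b≃b' = #-cong (◂-cong a≃a' b≃b')

  closure : (n : ℕ) (M : Λ A) → fvb M ≤ n → (ℕ → A) → Machine A
  closure n M p ρ = mach⟦ n ⟧ M p ◂ args n ρ

  closure-var : ∀ n k (p : fvb {A} (var k) ≤ n) ρ → closure n (var k) p ρ ≡ae #⁻¹ (ρ k)
  closure-var n k p ρ = ↠h⇒≡ae (subst₂ _↠h_ (cong (Pr n i ◂_) (args-env n ρ)) value (Pr-↠h i (env n ρ) []))
    where
    i = opposite (fromℕ< p)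
    value : #⁻¹ (lookup (env n ρ) i) ◂ [] ≡ #⁻¹ (ρ k)
    value = trans (◂-identityʳ _) (cong #⁻¹ (trans (lookup-env-opposite _ ρ) (cong ρ (Fin.toℕ-fromℕ< p))))

  closure-con : ∀ n a (p : fvb (con a) ≤ n) ρ → closure n (con a) p ρ ≡ae #⁻¹ a
  closure-con n a p ρ =
    ↠h⇒≡ae (subst₂ _↠h_ (cong (Cons n a ◂_) (args-env n ρ)) (◂-identityʳ _) (Cons-↠h a (env n ρ) []))

  closure-app : ∀ n P Q (p : fvb (app P Q) ≤ n) ρ →
    closure n (app P Q) p ρ ≡ae (closure n P (ℕ.m⊔n≤o⇒m≤o (fvb P) (fvb Q) p) ρ
                                   ◂ (# (closure n Q (ℕ.m⊔n≤o⇒n≤o (fvb P) (fvb Q) p) ρ) ∷ []))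
  closure-app n P Q p ρ =
    ↠h⇒≡ae (subst₂ _↠h_ (cong (AppM n (# X) (# Y) ◂_) (args-env n ρ)) value (AppM-↠h (env n ρ) (# X) (# Y) []))
    where
    open ≡-Reasoning
    X = mach⟦ n ⟧ P (ℕ.m⊔n≤o⇒m≤o (fvb P) (fvb Q) p)
    Y = mach⟦ n ⟧ Q (ℕ.m⊔n≤o⇒n≤o (fvb P) (fvb Q) p)
    xs = toList (env n ρ)
    value : #⁻¹ (foldl _·_ (# X) xs · foldl _·_ (# Y) xs) ◂ [] ≡ (X ◂ args n ρ) ◂ (# (Y ◂ args n ρ) ∷ [])
    value = begin
      #⁻¹ (foldl _·_ (# X) xs · foldl _·_ (# Y) xs) ◂ [] ≡⟨ ◂-identityʳ _ ⟩
      #⁻¹ (foldl _·_ (# X) xs · foldl _·_ (# Y) xs)      ≡⟨ cong₂ (λ a b → #⁻¹ (a · b)) (foldl-·-# X xs) (foldl-·-# Y xs) ⟩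
      #⁻¹ (# (X ◂ xs) · # (Y ◂ xs))                      ≡⟨ #⁻¹-· _ _ ⟩
      #⁻¹ (# (X ◂ xs)) ◂ (# (Y ◂ xs) ∷ [])                ≡⟨ cong (_◂ (# (Y ◂ xs) ∷ [])) (#⁻¹∘# (X ◂ xs)) ⟩
      (X ◂ xs) ◂ (# (Y ◂ xs) ∷ [])                        ≡⟨ cong (λ ys → (X ◂ ys) ◂ (# (Y ◂ ys) ∷ [])) (toList-env n ρ) ⟩
      (X ◂ args n ρ) ◂ (# (Y ◂ args n ρ) ∷ [])            ∎

  closure-◂ : ∀ n M (p : fvb M ≤ n) ρ a → closure n M p ρ ◂ (a ∷ []) ≡ mach⟦ n ⟧ M p ◂ args (suc n) (a ∷ρ ρ)
  closure-◂ n M p ρ a = trans (◂-assoc _ (args n ρ) (a ∷ [])) (cong (mach⟦ n ⟧ M p ◂_) (args-snoc n ρ a))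

  mach⟦⟧-tape : ∀ n M p → Machine.tape (mach⟦ n ⟧ M p) ≡ []
  mach⟦⟧-tape n (var x)   p = refl
  mach⟦⟧-tape n (con a)   p = refl
  mach⟦⟧-tape n (app M N) p = refl
  mach⟦⟧-tape n (lam M)   p = mach⟦⟧-tape (suc n) M _

  mach⟦⟧-loads : ∀ n M p → n ≤ length (Prog.loads (Machine.program (mach⟦ n ⟧ M p)))
  mach⟦⟧-loads n (var x)   p = ℕ.≤-reflexive (sym (length-prLoads _))
  mach⟦⟧-loads n (con a)   p = ℕ.≤-reflexive (sym (List.length-replicate n))
  mach⟦⟧-loads n (app M N) p = ℕ.≤-reflexive (sym (length-countFrom 0 n))
  mach⟦⟧-loads n (lam M)   p = ℕ.≤-trans (ℕ.n≤1+n n) (mach⟦⟧-loads (suc n) M _)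

  closure-lam-↠stuck : ∀ n M (p : fvb (lam M) ≤ n) ρ → closure n (lam M) p ρ ↠stuck
  closure-lam-↠stuck n M p ρ = ◂-↠stuck (mach⟦ n ⟧ (lam M) p) (args n ρ) (mach⟦⟧-tape n (lam M) p)
    (subst (_< _) (sym (length-args n ρ)) (mach⟦⟧-loads (suc n) M _))

  closure-lam-ext : ∀ {n m M N} {p : fvb (lam M) ≤ n} {q : fvb (lam N) ≤ m} {ρ ρ'} →
    (∀ a → (mach⟦ n ⟧ (lam M) p ◂ args (suc n) (a ∷ρ ρ)) ≡ae (mach⟦ m ⟧ (lam N) q ◂ args (suc m) (a ∷ρ ρ'))) →
    closure n (lam M) p ρ ≡ae closure m (lam N) q ρ'
  closure-lam-ext {n} {m} {M} {N} {p} {q} {ρ} {ρ'} extend =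
    ae-ext (closure-lam-↠stuck n M p ρ) (closure-lam-↠stuck m N q ρ') λ a →
      ae-trans (≡⇒≡ae (closure-◂ n (lam M) p ρ a))
        (ae-trans (extend a) (≡⇒≡ae (sym (closure-◂ m (lam N) q ρ' a))))

  closure-cong : ∀ {M N} → Λ-Rel _≃ae_ M N → ∀ {n m p q ρ ρ'} → (∀ x → x ∈FV M → ρ x ≃ae ρ' x) →
                 closure n M p ρ ≡ae closure m N q ρ'
  closure-cong (var k) {n} {m} {p} {q} {ρ} {ρ'} agree =
    ae-trans (closure-var n k p ρ) (ae-trans (agree k fv-var) (ae-sym (closure-var m k q ρ')))
  closure-cong (con a≃b) {n} {m} {p} {q} {ρ} {ρ'} agree =
    ae-trans (closure-con n _ p ρ) (ae-trans a≃b (ae-sym (closure-con m _ q ρ')))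
  closure-cong (app {M} {M'} {N} {N'} M≃M' N≃N') {n} {m} {p} {q} {ρ} {ρ'} agree =
    ae-trans (closure-app n M N p ρ)
      (ae-trans (◂-cong (closure-cong M≃M' (λ x x∈M → agree x (fv-appˡ x∈M)))
                        (#-cong (closure-cong N≃N' (λ x x∈N → agree x (fv-appʳ x∈N)))))
        (ae-sym (closure-app m M' N' q ρ')))
  closure-cong (lam {M} {N} M≃N) {n} {m} {p} {q} {ρ} {ρ'} agree =
    closure-lam-ext {n} {m} {M} {N} {p} {q} {ρ} {ρ'} λ a →
      closure-cong M≃N {suc n} {suc m} {ρ = a ∷ρ ρ} {a ∷ρ ρ'} (agree-∷ρ a)
    where
    agree-∷ρ : ∀ a x → x ∈FV M → (a ∷ρ ρ) x ≃ae (a ∷ρ ρ') x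
    agree-∷ρ a zero    _    = ae-refl
    agree-∷ρ a (suc x) x∈M = agree x (fv-lam x∈M)

  Λ-Rel-refl : ∀ M → Λ-Rel _≃ae_ M M
  Λ-Rel-refl (var x)   = var x
  Λ-Rel-refl (con a)   = con ae-refl
  Λ-Rel-refl (app M N) = app (Λ-Rel-refl M) (Λ-Rel-refl N)
  Λ-Rel-refl (lam M)   = lam (Λ-Rel-refl M)

  closure-⟦⟧ : ∀ {n} M {p} ρ → closure n M p ρ ≡ae #⁻¹ (⟦ M ⟧ ρ)
  closure-⟦⟧ M ρ = ae-trans (closure-cong (Λ-Rel-refl M) (λ _ _ → ae-refl)) (≡⇒≡ae (sym (#⁻¹∘# _)))

theorem4p10 : (A : Set) → A ↣ ℕ → (enc : Machine A ↔ A) →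
    IsSyntacticλModel (AddressingMachines._≃ae_ enc) (AddressingMachines._·_ enc)
                      (AddressingMachines.⟦_⟧_ enc)
theorem4p10 A _ enc = record
  { isEquivalence = record { refl = ae-refl ; sym = ae-sym ; trans = ae-trans }
  ; ·-cong  = ·-cong
  ; ⟦⟧-cong = λ M≃N ρ≃ρ' → #-cong (closure-cong M≃N (λ x _ → ρ≃ρ' x))
  ; ⟦var⟧   = λ x ρ → #-≃ae (closure-var (suc x) x ℕ.≤-refl ρ)
  ; ⟦con⟧   = λ a ρ → #-≃ae (closure-con 0 a z≤n ρ)
  ; ⟦app⟧   = λ P Q ρ → #-≃ae (ae-trans (closure-app _ P Q ℕ.≤-refl ρ)
                (ae-trans (◂-cong (closure-⟦⟧ P ρ) (#-≃ae (closure-⟦⟧ Q ρ))) (≡⇒≡ae (sym (#⁻¹-· _ _)))))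
  ; ⟦lam⟧β  = λ P ρ a → ae-trans
      (≡⇒≡ae (trans (#⁻¹-· _ a) (trans (cong (_◂ (a ∷ [])) (#⁻¹∘# _)) (closure-◂ _ (lam P) ℕ.≤-refl ρ a))))
      (closure-⟦⟧ P (a ∷ρ ρ))
  ; ⟦⟧-fv   = λ M ρ ρ' ρ≃ρ' → #-cong (closure-cong (Λ-Rel-refl M) ρ≃ρ')
  ; ⟦lam⟧ξ  = λ M N ρ M≃N → #-cong (closure-lam-ext {M = M} {N} {ℕ.≤-refl} {ℕ.≤-refl} {ρ} {ρ} λ a →
      ae-trans (closure-⟦⟧ M (a ∷ρ ρ)) (ae-trans (M≃N a) (ae-sym (closure-⟦⟧ N (a ∷ρ ρ)))))
  }
  where
  open AddressingMachines enc
  open Interpretation enc
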